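{- The set-function $\mathrm{Card}$ is not $(\oplus,\Downarrow,\mathcal{P})$-definable.
   Context: $\mathbb{N}=\{0,1,2,\ldots\}$, $2^{\mathbb{N}}$ is its power set. A set-function is a map $(2^{\mathbb{N}})^k\to2^{\mathbb{N}}$ for some $k\ge0$. For a collection $\mathcal{O}$ of set-functions, $\mathcal{O}$-circuits are terms built from variables ranging over $2^{\mathbb{N}}$, the constants $\emptyset$, $\mathbb{N}$, $\{n\}$ ($n\in\mathbb{N}$), the operations $\cup$, $\cap$, complement relative to $\mathbb{N}$, and the functions in $\mathcal{O}$; a set-function is $\mathcal{O}$-definable if some $\mathcal{O}$-circuit evaluates to it. $(\oplus,\Downarrow,\mathcal{P})$-definable means $(\{\oplus,\Downarrow\}\cup\mathcal{P})$-definable, where $s\oplus t=\{m+n\mid m\in s,n\in t\}$, $\Downarrow(x)=\{m\in\mathbb{N}\mid\exists n\in x,\ m\le n\}$, and $\mathcal{P}$ is the collection of all set-functions (all arities) whose values all lie in $\{\emptyset,\{0\}\}$. $\mathrm{Card}(x)=\{|x|\}$ if $x$ is finite and $\mathbb{N}$ otherwise. -}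

module Defs where

open import Level using (0ℓ)
open import Data.Nat using (ℕ; _+_; _≤_)
open import Data.Fin using (Fin)
open import Data.List using (List; length)
open import Data.List.Membership.Propositional using (_∈_)
open import Data.List.Relation.Unary.Unique.Propositional using (Unique)
open import Data.Product using (Σ; ∃; _×_; _,_)
open import Data.Sum using (_⊎_)
open import Data.Empty using (⊥)
open import Data.Unit using (⊤)
open import Relation.Nullary using (¬_)
open import Relation.Binary.PropositionalEquality using (_≡_)
open import Function.Bundles using (_⇔_)

SetN : Set₁
SetN = ℕ → Set

_≈ₛ_ : SetN → SetN → Set
s ≈ₛ t = ∀ m → s m ⇔ t m

∅ₛ : SetN
∅ₛ _ = ⊥

ℕₛ : SetN
ℕₛ _ = ⊤

｛_｝ : ℕ → SetN
｛ n ｝ m = m ≡ n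

_∪ₛ_ : SetN → SetN → SetN
(s ∪ₛ t) m = s m ⊎ t m

_∩ₛ_ : SetN → SetN → SetN
(s ∩ₛ t) m = s m × t m

∁ₛ : SetN → SetN
∁ₛ s m = ¬ s m

_⊕_ : SetN → SetN → SetN
(s ⊕ t) k = Σ ℕ λ a → Σ ℕ λ b → (a + b ≡ k) × s a × t b

⇓ : SetN → SetN
⇓ x m = Σ ℕ λ n → (m ≤ n) × x n

-- A k-ary set-function whose values all lie in {∅, {0}}.  Such a function
-- is exactly  xs ↦ { 0 | g xs }  for a proposition-valued g; set-functions
-- act on sets, so g must respect extensional equality of its arguments.
record PFun (k : ℕ) : Set₁ where
  field
    cond : (Fin k → SetN) → Set
    resp : ∀ xs ys → (∀ i → xs i ≈ₛ ys i) → cond xs ⇔ cond ys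

PFun-apply : ∀ {k} → PFun k → (Fin k → SetN) → SetN
PFun-apply f xs m = (m ≡ 0) × PFun.cond f xs

data Circuit (n : ℕ) : Set₁ where
  var   : Fin n → Circuit n
  empty : Circuit n
  full  : Circuit n
  sing  : ℕ → Circuit n
  union : Circuit n → Circuit n → Circuit n
  inter : Circuit n → Circuit n → Circuit n
  compl : Circuit n → Circuit n
  plus  : Circuit n → Circuit n → Circuit n
  down  : Circuit n → Circuit n
  pfun  : (k : ℕ) → PFun k → (Fin k → Circuit n) → Circuit n

⟦_⟧ : ∀ {n} → Circuit n → (Fin n → SetN) → SetN
⟦ var i ⟧ ρ = ρ i
⟦ empty ⟧ ρ = ∅ₛ
⟦ full ⟧ ρ = ℕₛ
⟦ sing n ⟧ ρ = ｛ n ｝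
⟦ union c d ⟧ ρ = ⟦ c ⟧ ρ ∪ₛ ⟦ d ⟧ ρ
⟦ inter c d ⟧ ρ = ⟦ c ⟧ ρ ∩ₛ ⟦ d ⟧ ρ
⟦ compl c ⟧ ρ = ∁ₛ (⟦ c ⟧ ρ)
⟦ plus c d ⟧ ρ = ⟦ c ⟧ ρ ⊕ ⟦ d ⟧ ρ
⟦ down c ⟧ ρ = ⇓ (⟦ c ⟧ ρ)
⟦ pfun k f cs ⟧ ρ = PFun-apply f (λ i → ⟦ cs i ⟧ ρ)

Definable : ∀ {n} → ((Fin n → SetN) → SetN) → Set₁
Definable {n} F = Σ (Circuit n) λ C → ∀ ρ → ⟦ C ⟧ ρ ≈ₛ F ρ

HasCard : SetN → ℕ → Set
HasCard x n = Σ (List ℕ) λ l → (length l ≡ n) × Unique l × (∀ m → x m ⇔ (m ∈ l))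

Finite : SetN → Set
Finite x = ∃ λ n → HasCard x n

Card : SetN → SetN
Card x m = HasCard x m ⊎ ¬ Finite x

module Submission where

-- Idea: a circuit can only "see" finitely many different behaviours on
-- the initial segment [0, M) as long as its inputs avoid [0, M).  To each
-- circuit C we attach a finite list of input-independent candidate sets
-- (of length  width C, which does not depend on M) and show: if every
-- input set lies in [M, ∞), then ⟦ C ⟧ agrees on [0, M) with one of the
-- candidates.  Constructively we only get this up to double negation
-- (the ⇓ and 𝒫 cases split on undecidable propositions), which suffices
-- because the goal is a negation.

open import Defs
open import Data.Fin using (Fin; zero; suc; toℕ; combine; remQuot)
open import Data.Fin.Properties using (remQuot-combine; pigeonhole; toℕ<n)
open import Data.Nat using (ℕ; zero; suc; _+_; _*_; _≤_; _<_; s≤s; _<?_)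
open import Data.Nat.Properties
  using (≤-trans; <-≤-trans; <⇒≤; m≤m+n; m≤n+m; +-cancelˡ-≡; <-irrefl; ≤-refl; ≮⇒≥)
open import Data.Product using (Σ; ∃; _×_; _,_; proj₁; proj₂)
open import Data.Product.Function.NonDependent.Propositional using (_×-⇔_)
open import Data.Sum using (inj₁; inj₂)
open import Data.Sum.Function.Propositional using (_⊎-⇔_)
open import Data.Unit using (tt)
open import Data.List using (List; map; upTo)
open import Data.List.Properties using (length-map; length-upTo)
open import Data.List.Membership.Propositional using (_∈_)
open import Data.List.Membership.Propositional.Properties using (∈-map⁻)
open import Data.List.Membership.Propositional.Properties.WithK using (unique∧set⇒bag)
import Data.List.Relation.Unary.Unique.Propositional.Properties as Unique
open import Data.List.Relation.Binary.BagAndSetEquality using (_∼[_]_; bag; ∼bag⇒↭)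
open import Data.List.Relation.Binary.Permutation.Propositional.Properties using (↭-length)
open import Effect.Monad using (RawMonad)
open import Function.Bundles using (_⇔_; mk⇔; Equivalence)
open import Function.Construct.Symmetry using (⇔-sym)
open import Function.Construct.Composition using (_⇔-∘_)
open import Function.Related.TypeIsomorphisms using (¬-cong-⇔)
open import Relation.Binary.PropositionalEquality using (_≡_; refl; sym; trans; cong; subst)
open import Relation.Nullary using (¬_; yes; no; ¬¬-excluded-middle)
open import Relation.Nullary.Negation using (DoubleNegation; ¬¬-Monad; contradiction)
open import Level using (0ℓ)

open Equivalence
open RawMonad (¬¬-Monad {0ℓ}) using (pure; _>>=_)

Agree : ℕ → SetN → SetN → Set
Agree M A B = ∀ m → m < M → A m ⇔ B m

Agree-sym : ∀ {M A B} → Agree M A B → Agree M B A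
Agree-sym A≈B m m<M = ⇔-sym (A≈B m m<M)

Agree-trans : ∀ {M A B C} → Agree M A B → Agree M B C → Agree M A C
Agree-trans A≈B B≈C m m<M = B≈C m m<M ⇔-∘ A≈B m m<M

-- The Boolean operations and ⊕ respect agreement on [0, M); for ⊕ this
-- holds because both summands of an m < M are themselves < M.
∪-agree : ∀ {M A A′ B B′} → Agree M A A′ → Agree M B B′ → Agree M (A ∪ₛ B) (A′ ∪ₛ B′)
∪-agree A≈ B≈ m m<M = A≈ m m<M ⊎-⇔ B≈ m m<M

∩-agree : ∀ {M A A′ B B′} → Agree M A A′ → Agree M B B′ → Agree M (A ∩ₛ B) (A′ ∩ₛ B′)
∩-agree A≈ B≈ m m<M = A≈ m m<M ×-⇔ B≈ m m<M

∁-agree : ∀ {M A A′} → Agree M A A′ → Agree M (∁ₛ A) (∁ₛ A′)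
∁-agree A≈ m m<M = ¬-cong-⇔ (A≈ m m<M)

⊕-agree : ∀ {M A A′ B B′} → Agree M A A′ → Agree M B B′ → Agree M (A ⊕ B) (A′ ⊕ B′)
⊕-agree {M} A≈ B≈ k k<M = mk⇔
  (λ { (a , b , a+b≡k , x , y) →
         a , b , a+b≡k , to (A≈ a (left< a+b≡k)) x , to (B≈ b (right< a+b≡k)) y })
  (λ { (a , b , a+b≡k , x , y) →
         a , b , a+b≡k , from (A≈ a (left< a+b≡k)) x , from (B≈ b (right< a+b≡k)) y })
  where
  left< : ∀ {a b} → a + b ≡ k → a < M
  left< {a} {b} refl = <-≤-trans (s≤s (m≤m+n a b)) k<M
  right< : ∀ {a b} → a + b ≡ k → b < M
  right< {a} {b} refl = <-≤-trans (s≤s (m≤n+m b a)) k<M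

_↾_ : SetN → ℕ → SetN
(A ↾ M) m = (m < M) × A m

Reaches : ℕ → SetN → Set
Reaches M x = ∃ λ n → (M ≤ n) × x n

⇓-reaching : ∀ {M x} → Reaches M x → Agree M (⇓ x) ℕₛ
⇓-reaching (n , M≤n , x) m m<M = mk⇔ (λ _ → tt) (λ _ → n , ≤-trans (<⇒≤ m<M) M≤n , x)

⇓-bounded : ∀ {M x E} → ¬ Reaches M x → Agree M x E → Agree M (⇓ x) (⇓ (E ↾ M))
⇓-bounded {M} {x} unreached x≈E m m<M = mk⇔
  (λ { (n , m≤n , xn) → n , m≤n , below xn , to (x≈E n (below xn)) xn })
  (λ { (n , m≤n , n<M , En) → n , m≤n , from (x≈E n n<M) En })
  where
  below : ∀ {n} → x n → n < M
  below {n} xn with n <? M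
  ... | yes n<M = n<M
  ... | no n≮M = contradiction (n , ≮⇒≥ n≮M , xn) unreached

-- The number of candidates, width C, is
-- independent of M; a binary gate pairs up the candidates of its inputs,
-- ⇓ adds ℕ (for an argument reaching M), and an element of 𝒫 has the two
-- candidates ∅ and {0}.
width : ∀ {n} → Circuit n → ℕ
width (var i)      = 1
width empty        = 1
width full         = 1
width (sing k)     = 1
width (union c d)  = width c * width d
width (inter c d)  = width c * width d
width (compl c)    = width c
width (plus c d)   = width c * width d
width (down c)     = suc (width c)
width (pfun k f cs) = 2

pairwise : ∀ {a b} → (SetN → SetN → SetN) → (Fin a → SetN) → (Fin b → SetN) → Fin (a * b) → SetN
pairwise {a} {b} op E F t = op (E (proj₁ (remQuot {a} b t))) (F (proj₂ (remQuot {a} b t)))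

pairwise-combine : ∀ {a b} op (E : Fin a → SetN) (F : Fin b → SetN) i j →
                   pairwise op E F (combine i j) ≡ op (E i) (F j)
pairwise-combine {a} {b} op E F i j =
  cong (λ p → op (E (proj₁ p)) (F (proj₂ p))) (remQuot-combine {a} {b} i j)

candidate : ℕ → ∀ {n} → (C : Circuit n) → Fin (width C) → SetN
candidate M (var i)       _       = ∅ₛ
candidate M empty         _       = ∅ₛ
candidate M full          _       = ℕₛ
candidate M (sing k)      _       = ｛ k ｝
candidate M (union c d)           = pairwise _∪ₛ_ (candidate M c) (candidate M d)
candidate M (inter c d)           = pairwise _∩ₛ_ (candidate M c) (candidate M d)
candidate M (compl c)     t       = ∁ₛ (candidate M c t)
candidate M (plus c d)            = pairwise _⊕_ (candidate M c) (candidate M d)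
candidate M (down c)      zero    = ℕₛ
candidate M (down c)      (suc t) = ⇓ (candidate M c t ↾ M)
candidate M (pfun k f cs) zero    = ∅ₛ
candidate M (pfun k f cs) (suc _) = ｛ 0 ｝

Matches : ℕ → ∀ {n} → Circuit n → SetN → Set
Matches M C A = Σ (Fin (width C)) λ t → Agree M A (candidate M C t)

pairwise-matches : ∀ {M a b A B} {E : Fin a → SetN} {F : Fin b → SetN} op →
  (∀ {A A′ B B′} → Agree M A A′ → Agree M B B′ → Agree M (op A B) (op A′ B′)) →
  (∃ λ i → Agree M A (E i)) → (∃ λ j → Agree M B (F j)) →
  Σ (Fin (a * b)) λ t → Agree M (op A B) (pairwise op E F t)
pairwise-matches {E = E} {F} op op-agree (i , A≈) (j , B≈) =
  combine i j ,
  subst (Agree _ _) (sym (pairwise-combine op E F i j)) (op-agree A≈ B≈)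

Above : ℕ → SetN → Set
Above M x = ∀ m → x m → M ≤ m

agrees-with-candidate : ∀ M {n} (C : Circuit n) (ρ : Fin n → SetN) →
  (∀ i → Above M (ρ i)) → DoubleNegation (Matches M C (⟦ C ⟧ ρ))
-- A variable is ∅ on [0, M) since its value lies in [M, ∞).
agrees-with-candidate M (var i) ρ above =
  pure (zero , λ m m<M → mk⇔ (λ x → <-irrefl refl (<-≤-trans m<M (above i m x))) λ ())
agrees-with-candidate M empty    ρ above = pure (zero , λ m _ → mk⇔ (λ x → x) (λ x → x))
agrees-with-candidate M full     ρ above = pure (zero , λ m _ → mk⇔ (λ x → x) (λ x → x))
agrees-with-candidate M (sing k) ρ above = pure (zero , λ m _ → mk⇔ (λ x → x) (λ x → x))
agrees-with-candidate M (union c d) ρ above = do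
  mc ← agrees-with-candidate M c ρ above
  md ← agrees-with-candidate M d ρ above
  pure (pairwise-matches _∪ₛ_ ∪-agree mc md)
agrees-with-candidate M (inter c d) ρ above = do
  mc ← agrees-with-candidate M c ρ above
  md ← agrees-with-candidate M d ρ above
  pure (pairwise-matches _∩ₛ_ ∩-agree mc md)
agrees-with-candidate M (plus c d) ρ above = do
  mc ← agrees-with-candidate M c ρ above
  md ← agrees-with-candidate M d ρ above
  pure (pairwise-matches _⊕_ ⊕-agree mc md)
agrees-with-candidate M (compl c) ρ above = do
  (t , c≈) ← agrees-with-candidate M c ρ above
  pure (t , ∁-agree c≈)
agrees-with-candidate M (down c) ρ above =
  ¬¬-excluded-middle {A = Reaches M (⟦ c ⟧ ρ)} >>= λ where
    (yes reaches) → pure (zero , ⇓-reaching reaches)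
    (no unreached) → do
      (t , c≈) ← agrees-with-candidate M c ρ above
      pure (suc t , ⇓-bounded unreached c≈)
agrees-with-candidate M (pfun k f cs) ρ above =
  ¬¬-excluded-middle {A = PFun.cond f (λ i → ⟦ cs i ⟧ ρ)} >>= λ where
    (yes holds) → pure (suc zero , λ m _ → mk⇔ proj₁ (λ m≡0 → m≡0 , holds))
    (no fails)  → pure (zero , λ m _ → mk⇔ (λ (_ , holds) → fails holds) λ ())

¬¬-finite-choice : ∀ N {P : Fin N → Set} → (∀ j → DoubleNegation (P j)) → DoubleNegation (∀ j → P j)
¬¬-finite-choice zero    h = pure λ ()
¬¬-finite-choice (suc N) h = do
  p₀ ← h zero
  ps ← ¬¬-finite-choice N (λ j → h (suc j))
  pure λ { zero → p₀ ; (suc j) → ps j }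

-- Cardinality is well defined: two duplicate-free enumerations of the
-- same set are permutations of each other.
HasCard-unique : ∀ {x j k} → HasCard x j → HasCard x k → j ≡ k
HasCard-unique (l , len-l , unique-l , x⇔l) (l′ , len-l′ , unique-l′ , x⇔l′) =
  trans (sym len-l) (trans (↭-length (∼bag⇒↭ l≋l′)) len-l′)
  where
  l≋l′ : l ∼[ bag ] l′
  l≋l′ = unique∧set⇒bag unique-l unique-l′
           (λ {z} → x⇔l′ z ⇔-∘ ⇔-sym (x⇔l z))

Card-finite : ∀ {x j m} → HasCard x j → Card x m → m ≡ j
Card-finite x-size (inj₁ x-size′) = HasCard-unique x-size′ x-size
Card-finite x-size (inj₂ infinite) = contradiction (_ , x-size) infinite

block : ℕ → ℕ → List ℕ
block M j = map (M +_) (upTo j)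

Block : ℕ → ℕ → SetN
Block M j m = m ∈ block M j

Block-above : ∀ {M j} → Above M (Block M j)
Block-above {M} m m∈block with ∈-map⁻ (M +_) m∈block
... | a , _ , refl = m≤m+n M a

Block-size : ∀ M j → HasCard (Block M j) j
Block-size M j =
  block M j ,
  trans (length-map (M +_) (upTo j)) (length-upTo j) ,
  Unique.map⁺ (+-cancelˡ-≡ M _ _) (Unique.upTo⁺ j) ,
  λ m → mk⇔ (λ x → x) (λ x → x)

Card-separates-blocks : ∀ {M i j} → i < M →
  Agree M (Card (Block M i)) (Card (Block M j)) → i ≡ j
Card-separates-blocks {M} {i} {j} i<M Card≈ =
  Card-finite (Block-size M j) (to (Card≈ i i<M) (inj₁ (Block-size M i)))

corollary6 : ¬ Definable {1} (λ ρ → Card (ρ zero))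
corollary6 (C , C≈Card) =
  ¬¬-finite-choice M (λ j → agrees-with-candidate M C (input j) (λ _ → Block-above)) collision
  where
  M : ℕ
  M = suc (width C)
  input : Fin M → Fin 1 → SetN
  input j _ = Block M (toℕ j)
  -- M inputs, fewer than M candidates: two inputs share a candidate,
  -- so Card would agree on their blocks below M.
  collision : ¬ (∀ j → Matches M C (⟦ C ⟧ (input j)))
  collision match with pigeonhole ≤-refl (λ j → proj₁ (match j))
  ... | i , j , i<j , same = <-irrefl (Card-separates-blocks (toℕ<n i) Card≈) i<j
    where
    Card-matches : ∀ k → Agree M (Card (Block M (toℕ k))) (candidate M C (proj₁ (match k)))
    Card-matches k = Agree-trans (λ m _ → ⇔-sym (C≈Card (input k) m)) (proj₂ (match k))
    Card≈ : Agree M (Card (Block M (toℕ i))) (Card (Block M (toℕ j)))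
    Card≈ = Agree-trans (Card-matches i)
              (subst (λ X → Agree M X _) (cong (candidate M C) (sym same)) (Agree-sym (Card-matches j)))
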